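{- Let $p$ be a prime, let $m\ge 1$ be an integer, and let $(a_n^{(i)})_{n\ge 0}$, $i=1,\dots,m+1$, be sequences of elements of $\mathbb{Q}_p$ (all infinite, or all finite of the same length) with $a_0^{(m+1)}=1$. Define $A_{ -j}^{(i)}=\delta_{ij}$ for $j=1,\dots,m$, $i=1,\dots,m+1$, $A_0^{(i)}=a_0^{(i)}$, and $A_n^{(i)}=\sum_{j=1}^{m+1}a_n^{(j)}A_{n-j}^{(i)}$ for $n\ge1$. Assume that for every $n\ge 1$, $$|a_n^{(1)}|\ge 1\quad\text{and}\quad |a_n^{(i)}|<|a_n^{(1)}|\ \text{ for } i=2,\dots,m+1,$$ where $|\cdot|$ is the $p$-adic absolute value. Then for every $n\ge 1$, $$|A_n^{(m+1)}|=\prod_{h=1}^n |a_h^{(1)}|.$$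
   Context: $\delta_{ij}$ denotes the Kronecker delta. The sequences $(a_n^{(i)})$ are the partial quotients of a multidimensional continued fraction of dimension $m$, and $A_n^{(i)}$ are the numerators ($i\le m$) and denominators ($i=m+1$) of its convergents. -}

module Defs where

open import Level using (Level)
open import Algebra.Bundles using (CommutativeRing)
open import Data.Nat as ℕ using (ℕ; zero; suc; _^_; _∸_)
open import Data.Integer as ℤ using (ℤ; +_; -[1+_])
open import Data.Maybe using (Maybe; just; nothing)
open import Data.Fin using (Fin; zero; suc; toℕ)
open import Data.Vec using (Vec; []; _∷_; lookup; tabulate)
open import Data.Product using (_×_; ∃)
open import Data.Nat.Primality using (Prime)
open import Data.Rational.Unnormalised as Q using (ℚᵘ; mkℚᵘ; 0ℚᵘ; 1ℚᵘ)
open import Relation.Binary.PropositionalEquality using (_≡_)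
open import Relation.Nullary using (¬_)

-- Extended integers ℤ ∪ {∞}, with nothing = ∞ (valuation of 0).
ℤ∞ : Set
ℤ∞ = Maybe ℤ

_+∞_ : ℤ∞ → ℤ∞ → ℤ∞
just a +∞ just b = just (a ℤ.+ b)
_      +∞ _      = nothing

data _≤∞_ : ℤ∞ → ℤ∞ → Set where
  ≤∞-∞  : ∀ {a} → a ≤∞ nothing
  ≤∞-ℤ  : ∀ {a b} → a ℤ.≤ b → just a ≤∞ just b

min∞ : ℤ∞ → ℤ∞ → ℤ∞
min∞ nothing b = b
min∞ (just a) nothing = just a
min∞ (just a) (just b) = just (a ℤ.⊓ b)

-- The p-adic absolute value attached to a valuation: |x| = p^(-v(x)), |0| = 0.
absVal : ℕ → ℤ∞ → ℚᵘ
absVal p nothing = 0ℚᵘ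
absVal p (just (+ k)) = mkℚᵘ (+ 1) (p ^ k ∸ 1)
absVal p (just -[1+ k ]) = mkℚᵘ (+ (p ^ suc k)) 0

module _ {c ℓ : Level} (K : CommutativeRing c ℓ) where
  open CommutativeRing K using (Carrier; _≈_; _+_; _*_; 0#; 1#)

  natK : ℕ → Carrier
  natK zero = 0#
  natK (suc n) = 1# + natK n

  -- A field with a discrete valuation normalised at the prime p
  -- (v(p) = 1); ℚ_p with v_p is the motivating instance.
  record PAdicValuedField (p : ℕ) : Set (c Level.⊔ ℓ) where
    field
      prime    : Prime p
      nontriv  : ¬ (1# ≈ 0#)
      inverse  : ∀ x → ¬ (x ≈ 0#) → ∃ λ y → (x * y) ≈ 1#
      v        : Carrier → ℤ∞
      v-cong   : ∀ {x y} → x ≈ y → v x ≡ v y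
      v-∞⇒0    : ∀ x → v x ≡ nothing → x ≈ 0#
      v-0      : v 0# ≡ nothing
      v-mul    : ∀ x y → v (x * y) ≡ v x +∞ v y
      v-add    : ∀ x y → min∞ (v x) (v y) ≤∞ v (x + y)
      v-p      : v (natK p) ≡ just (+ 1)

    ∣_∣ₚ : Carrier → ℚᵘ
    ∣ x ∣ₚ = absVal p (v x)

  sumFin : ∀ {k} → (Fin k → Carrier) → Carrier
  sumFin {zero} f = 0#
  sumFin {suc k} f = f zero + sumFin (λ j → f (suc j))

  -- Partial quotients: a n i = a_n^{(i+1)} for i : Fin (suc m).
  -- State at step n: the vector (A_n, A_{n-1}, ..., A_{n-m}), each entry an
  -- element of Fin (suc m) → Carrier indexed by the upper index (i+1).
  initState : (m : ℕ) → (ℕ → Fin (suc m) → Carrier) → Vec (Fin (suc m) → Carrier) (suc m)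
  initState m a = a 0 ∷ tabulate (λ (j : Fin m) (i : Fin (suc m)) → δ (toℕ i) (toℕ j))
    where
      -- A_{-(j+1)}^{(i+1)} = δ_{i+1, j+1}
      δ : ℕ → ℕ → Carrier
      δ zero zero = 1#
      δ zero (suc _) = 0#
      δ (suc _) zero = 0#
      δ (suc x) (suc y) = δ x y

  shiftIn : ∀ {A : Set c} {k} → A → Vec A (suc k) → Vec A (suc k)
  shiftIn {k = zero} x (_ ∷ []) = x ∷ []
  shiftIn {k = suc k} x (y ∷ ys) = x ∷ shiftIn y ys

  state : (m : ℕ) → (ℕ → Fin (suc m) → Carrier) → ℕ → Vec (Fin (suc m) → Carrier) (suc m)
  state m a zero = initState m a
  state m a (suc n) = shiftIn new s
    where
      s = state m a n
      new : Fin (suc m) → Carrier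
      new i = sumFin (λ j → a (suc n) j * lookup s j i)

  convergent : (m : ℕ) → (ℕ → Fin (suc m) → Carrier) → ℕ → Fin (suc m) → Carrier
  convergent m a n = lookup (state m a n) zero

prodQ : (ℕ → ℚᵘ) → ℕ → ℚᵘ
prodQ f zero = 1ℚᵘ
prodQ f (suc n) = prodQ f n Q.* f (suc n)

-- Write ζₕ = v(aₕ⁽¹⁾) ≤ 0. Along the last column, the window A_n, …, A_{n-m} has all
-- valuations ≥ ζ₁ + ⋯ + ζₙ, with equality at A_n. Indeed, in
-- A_{n+1} = a_{n+1}⁽¹⁾ A_n + Σ_{j≥2} a_{n+1}⁽ʲ⁾ A_{n+1-j} the first summand has valuation
-- exactly ζ_{n+1} + ζ₁ + ⋯ + ζₙ while every other summand has strictly larger valuation,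
-- so the ultrametric inequality is an equality; and as ζ_{n+1} ≤ 0 the lower bound
-- survives the shift of the window. Initially A_0⁽ᵐ⁺¹⁾ = 1 and the other entries are 0.
module Submission where

open import Defs
open import Level using (Level)
open import Algebra.Bundles using (CommutativeRing)
open import Data.Nat using (ℕ; suc; _≤_)
open import Data.Fin using (Fin; zero; suc; fromℕ)
open import Data.Rational.Unnormalised as Q using (ℚᵘ; 1ℚᵘ)
open import Data.Product using (_×_)

open import Data.Nat as ℕ using (zero; _^_; _∸_; z≤n; s≤s)
import Data.Nat.Properties as ℕP
open import Data.Nat.Primality using (prime⇒nonTrivial)
open import Data.Integer as ℤ using (ℤ; +_; -[1+_]; -<+; +<+; -<-; +≤+)
import Data.Integer.Properties as ℤP
open import Algebra.Properties.AbelianGroup ℤP.+-0-abelianGroup using (identityˡ-unique)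
import Data.Rational.Unnormalised.Properties as QP
open import Data.Fin using (toℕ)
import Data.Fin.Properties as FinP
open import Data.Vec using (Vec; []; _∷_; lookup; tabulate)
open import Data.Vec.Properties using (lookup∘tabulate)
open import Data.Maybe using (just; nothing)
open import Data.Maybe.Properties using (just-injective)
open import Data.Product using (_,_; proj₁; proj₂)
open import Data.Sum using (inj₁; inj₂)
open import Data.Unit using (⊤; tt)
open import Data.Empty using (⊥-elim)
open import Relation.Nullary using (yes; no)
open import Relation.Binary.PropositionalEquality
  using (_≡_; refl; sym; trans; cong; cong₂; subst; subst₂; cong-app; module ≡-Reasoning)

infix 4 _<∞_
_<∞_ : ℤ → ℤ∞ → Set
z <∞ nothing = ⊤
z <∞ just w  = z ℤ.< w

<∞-min∞ : ∀ {z} x y → z <∞ x → z <∞ y → z <∞ min∞ x y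
<∞-min∞ nothing  y        _   z<y = z<y
<∞-min∞ (just x) nothing  z<x _   = z<x
<∞-min∞ (just x) (just y) z<x z<y with ℤP.⊓-sel x y
... | inj₁ x⊓y≡x = subst (_ ℤ.<_) (sym x⊓y≡x) z<x
... | inj₂ x⊓y≡y = subst (_ ℤ.<_) (sym x⊓y≡y) z<y

<∞-≤∞-trans : ∀ {z x y} → z <∞ x → x ≤∞ y → z <∞ y
<∞-≤∞-trans _   ≤∞-∞         = tt
<∞-≤∞-trans z<x (≤∞-ℤ x≤y) = ℤP.<-≤-trans z<x x≤y

≤-≤∞-trans : ∀ {a b w} → a ℤ.≤ b → just b ≤∞ w → just a ≤∞ w
≤-≤∞-trans a≤b ≤∞-∞         = ≤∞-∞
≤-≤∞-trans a≤b (≤∞-ℤ b≤w) = ≤∞-ℤ (ℤP.≤-trans a≤b b≤w)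

+-mono-<∞-≤∞ : ∀ {α β} x y → α <∞ x → just β ≤∞ y → α ℤ.+ β <∞ x +∞ y
+-mono-<∞-≤∞ nothing  y        _   _            = tt
+-mono-<∞-≤∞ (just x) nothing  _   ≤∞-∞         = tt
+-mono-<∞-≤∞ (just x) (just y) α<x (≤∞-ℤ β≤y) = ℤP.+-mono-<-≤ α<x β≤y

min∞-just-<∞ : ∀ {z} w → z <∞ w → min∞ (just z) w ≡ just z
min∞-just-<∞ nothing  _   = refl
min∞-just-<∞ (just w) z<w = cong just (ℤP.i≤j⇒i⊓j≡i (ℤP.<⇒≤ z<w))

min∞-≤∞-<∞ : ∀ {z} x w → z <∞ w → min∞ x w ≤∞ just z → x ≤∞ just z
min∞-≤∞-<∞ nothing  (just w) z<w (≤∞-ℤ w≤z) = ⊥-elim (ℤP.<⇒≱ z<w w≤z)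
min∞-≤∞-<∞ (just x) nothing  _   x≤z        = x≤z
min∞-≤∞-<∞ (just x) (just w) z<w (≤∞-ℤ x⊓w≤z) with ℤP.⊓-sel x w
... | inj₁ x⊓w≡x = ≤∞-ℤ (subst (ℤ._≤ _) x⊓w≡x x⊓w≤z)
... | inj₂ x⊓w≡w = ⊥-elim (ℤP.<⇒≱ z<w (subst (ℤ._≤ _) x⊓w≡w x⊓w≤z))

≤∞-antisym-just : ∀ {x z} → just z ≤∞ x → x ≤∞ just z → x ≡ just z
≤∞-antisym-just (≤∞-ℤ z≤x) (≤∞-ℤ x≤z) = cong just (ℤP.≤-antisym x≤z z≤x)

module Valuation {c ℓ} {K : CommutativeRing c ℓ} {p : ℕ} (VF : PAdicValuedField K p) where
  open CommutativeRing K
    using (Carrier; _≈_; _+_; _*_; -_; 1#; ring; *-identityˡ; +-assoc; +-congˡ; -‿inverseʳ; +-identityʳ)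
    renaming (sym to ≈-sym; trans to ≈-trans)
  open import Algebra.Properties.Ring ring using (-1*x≈-x; -‿involutive)
  open PAdicValuedField VF

  v-1# : v 1# ≡ just (+ 0)
  v-1# with v 1# in v1≡ | trans (sym (v-cong (*-identityˡ 1#))) (v-mul 1# 1#)
  ... | nothing | _          = ⊥-elim (nontriv (v-∞⇒0 1# v1≡))
  ... | just z  | z≡z+z = cong just (identityˡ-unique z z (sym (just-injective z≡z+z)))

  v-neg : ∀ x → v (- x) ≡ v x
  v-neg x = begin
    v (- x)              ≡⟨ v-cong (≈-sym (-1*x≈-x x)) ⟩
    v (- 1# * x)         ≡⟨ v-mul (- 1#) x ⟩
    v (- 1#) +∞ v x      ≡⟨ cong (_+∞ v x) v-neg-1# ⟩
    just (+ 0) +∞ v x    ≡⟨ +∞-identityˡ (v x) ⟩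
    v x                  ∎
    where
    open ≡-Reasoning

    +∞-identityˡ : ∀ w → just (+ 0) +∞ w ≡ w
    +∞-identityˡ nothing  = refl
    +∞-identityˡ (just z) = cong just (ℤP.+-identityˡ z)

    square-zero : ∀ w → w +∞ w ≡ just (+ 0) → w ≡ just (+ 0)
    square-zero (just (+ zero)) _ = refl

    v-neg-1# : v (- 1#) ≡ just (+ 0)
    v-neg-1# = square-zero (v (- 1#))
      (trans (sym (v-mul (- 1#) (- 1#))) (trans (v-cong (≈-trans (-1*x≈-x (- 1#)) (-‿involutive 1#))) v-1#))

  v-+-dominant : ∀ {x y z} → v x ≡ just z → z <∞ v y → v (x + y) ≡ just z
  v-+-dominant {x} {y} {z} vx≡z z<vy = ≤∞-antisym-just lower upper
    where
    lower : just z ≤∞ v (x + y)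
    lower = subst (_≤∞ v (x + y)) (trans (cong (λ t → min∞ t (v y)) vx≡z) (min∞-just-<∞ (v y) z<vy))
                  (v-add x y)
    x+y-y≈x : (x + y) + (- y) ≈ x
    x+y-y≈x = ≈-trans (+-assoc x y (- y)) (≈-trans (+-congˡ (-‿inverseʳ y)) (+-identityʳ x))
    upper : v (x + y) ≤∞ just z
    upper = min∞-≤∞-<∞ (v (x + y)) (v y) z<vy
              (subst₂ _≤∞_ (cong (min∞ (v (x + y))) (v-neg y)) (trans (v-cong x+y-y≈x) vx≡z)
                      (v-add (x + y) (- y)))

  <∞-v-sumFin : ∀ {k z} (f : Fin k → Carrier) → (∀ j → z <∞ v (f j)) → z <∞ v (sumFin K f)
  <∞-v-sumFin {zero}  f _   = subst (_ <∞_) (sym v-0) tt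
  <∞-v-sumFin {suc k} f z<f = <∞-≤∞-trans
    (<∞-min∞ (v (f zero)) _ (z<f zero) (<∞-v-sumFin (λ j → f (suc j)) (λ j → z<f (suc j))))
    (v-add (f zero) (sumFin K (λ j → f (suc j))))

  v-sumFin-dominant : ∀ {k z} (f : Fin (suc k) → Carrier) →
                      v (f zero) ≡ just z → (∀ j → z <∞ v (f (suc j))) → v (sumFin K f) ≡ just z
  v-sumFin-dominant f vf₀≡z z<f = v-+-dominant vf₀≡z (<∞-v-sumFin (λ j → f (suc j)) z<f)

absℤ∞ : ℤ∞ → ℕ
absℤ∞ nothing  = 0
absℤ∞ (just z) = ℤ.∣ z ∣

partialSum : (ℕ → ℕ) → ℕ → ℕ
partialSum e zero    = 0
partialSum e (suc n) = partialSum e n ℕ.+ e (suc n)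

module AbsoluteValue (p : ℕ) (1<p : 1 ℕ.< p) where

  instance
    p-nonZero : ℕ.NonZero p
    p-nonZero = ℕ.>-nonZero (ℕP.<⇒≤ 1<p)

  pow : ℕ → ℚᵘ
  pow k = Q.mkℚᵘ (+ (p ^ k)) 0

  pow-+ : ∀ k l → pow k Q.* pow l Q.≃ pow (k ℕ.+ l)
  pow-+ k l = Q.*≡* (cong (ℤ._* + 1)
    (trans (sym (ℤP.pos-* (p ^ k) (p ^ l))) (cong +_ (sym (ℕP.^-distribˡ-+-* p k l)))))

  pow-cancel-< : ∀ {k l} → pow k Q.< pow l → k ℕ.< l
  pow-cancel-< {k} {l} (Q.*<* pᵏ<pˡ) with k ℕP.<? l
  ... | yes k<l = k<l
  ... | no  k≮l = ⊥-elim (ℕP.<⇒≱ (ℤP.drop‿+<+ (subst₂ ℤ._<_ (ℤP.*-identityʳ _) (ℤP.*-identityʳ _) pᵏ<pˡ))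
                                 (ℕP.^-monoʳ-≤ p (ℕP.≮⇒≥ k≮l)))

  absVal-neg : ∀ k → absVal p (just (ℤ.- (+ k))) ≡ pow k
  absVal-neg zero    = refl
  absVal-neg (suc k) = refl

  1≤absVal⇒nonpositive : ∀ w → 1ℚᵘ Q.≤ absVal p w → w ≡ just (ℤ.- (+ absℤ∞ w))
  1≤absVal⇒nonpositive nothing           (Q.*≤* (+≤+ ()))
  1≤absVal⇒nonpositive (just (+ zero))   _ = refl
  1≤absVal⇒nonpositive (just -[1+ k ])   _ = refl
  1≤absVal⇒nonpositive (just (+ suc k)) (Q.*≤* 1≤p⁻ᵏ) = ⊥-elim (ℕP.<⇒≱ (ℕP.m<n⇒0<n∸m 1<pᵏ) pᵏ∸1≤0)
    where
    1<pᵏ : 1 ℕ.< p ^ suc k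
    1<pᵏ = ℕP.^-monoʳ-< p 1<p {0} {suc k} ℕ.z<s
    pᵏ∸1≤0 : p ^ suc k ∸ 1 ℕ.≤ 0
    pᵏ∸1≤0 = ℕP.≤-pred (ℤP.drop‿+≤+ (subst₂ ℤ._≤_ (ℤP.*-identityˡ _) (ℤP.*-identityˡ _) 1≤p⁻ᵏ))

  absVal<pow⇒<∞ : ∀ k w → absVal p w Q.< pow k → ℤ.- (+ k) <∞ w
  absVal<pow⇒<∞ k       nothing           _ = tt
  absVal<pow⇒<∞ zero    (just (+ zero))   1<1 = ⊥-elim (QP.<-irrefl-≡ refl 1<1)
  absVal<pow⇒<∞ zero    (just (+ suc j))  _ = +<+ (s≤s z≤n)
  absVal<pow⇒<∞ (suc k) (just (+ j))      _ = -<+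
  absVal<pow⇒<∞ zero    (just -[1+ j ])   pʲ<1 with () ← pow-cancel-< {suc j} {zero} pʲ<1
  absVal<pow⇒<∞ (suc k) (just -[1+ j ])   pʲ<pᵏ = -<- (ℕP.≤-pred (pow-cancel-< pʲ<pᵏ))

  prodQ-pow : ∀ (f : ℕ → ℚᵘ) e n → (∀ h → 1 ≤ h → h ≤ n → f h ≡ pow (e h)) →
              prodQ f n Q.≃ pow (partialSum e n)
  prodQ-pow f e zero    _      = QP.≃-refl
  prodQ-pow f e (suc n) f≡pow = QP.≃-trans
    (QP.*-cong (prodQ-pow f e n (λ h 1≤h h≤n → f≡pow h 1≤h (ℕP.m≤n⇒m≤1+n h≤n)))
               (QP.≃-reflexive (f≡pow (suc n) (s≤s z≤n) ℕP.≤-refl)))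
    (pow-+ (partialSum e n) (e (suc n)))

module Recurrence {c ℓ} (K : CommutativeRing c ℓ) where
  open CommutativeRing K using (Carrier; 0#)

  lookup-shiftIn-zero : ∀ {A : Set c} {k} (x : A) (s : Vec A (suc k)) → lookup (shiftIn K x s) zero ≡ x
  lookup-shiftIn-zero {k = zero}  x (_ ∷ []) = refl
  lookup-shiftIn-zero {k = suc k} x (_ ∷ _)  = refl

  shiftIn-preserves : ∀ {A : Set c} {k} (P : A → Set) {x : A} {s : Vec A (suc k)} →
                      P x → (∀ j → P (lookup s j)) → ∀ j → P (lookup (shiftIn K x s) j)
  shiftIn-preserves {k = zero}  P {s = _ ∷ []} Px _  zero    = Px
  shiftIn-preserves {k = suc k} P {s = _ ∷ _}  Px _  zero    = Px
  shiftIn-preserves {k = suc k} P {s = _ ∷ _}  Px Ps (suc j) = shiftIn-preserves P (Ps zero) (λ j → Ps (suc j)) j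

  below-diagonal : (δ : ℕ → ℕ → Carrier) → (∀ x y → δ (suc x) (suc y) ≡ δ x y) →
                   (∀ x → δ (suc x) zero ≡ 0#) → ∀ {x y} → y ℕ.< x → δ x y ≡ 0#
  below-diagonal δ δ-suc δ-zero {suc x} {zero}  _         = δ-zero x
  below-diagonal δ δ-suc δ-zero {suc x} {suc y} (s≤s y<x) = trans (δ-suc x y) (below-diagonal δ δ-suc δ-zero y<x)

  lookup-suc-∷-tabulate : ∀ {a} {A : Set a} {n} {w : Vec A (suc n)} {x f} →
                          w ≡ x ∷ tabulate f → ∀ j → lookup w (suc j) ≡ f j
  lookup-suc-∷-tabulate refl j = lookup∘tabulate _ j

  -- The Kronecker delta of initState is local to Defs; abstracting its arguments
  -- with 'with' lets unification name it.
  initState-fromℕ : ∀ m a (j : Fin m) → lookup (initState K m a) (suc j) (fromℕ m) ≡ 0#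
  initState-fromℕ m a j
    rewrite cong-app (lookup-suc-∷-tabulate {w = initState K m a} refl j) (fromℕ m)
    with below-diagonal _ (λ _ _ → refl) (λ _ → refl)
       | toℕ (fromℕ m) | toℕ j | subst (toℕ j ℕ.<_) (sym (FinP.toℕ-fromℕ m)) (FinP.toℕ<n j)
  ... | δ-vanishes | x | y | y<x = δ-vanishes y<x

module ConvergentValuation {c ℓ} {K : CommutativeRing c ℓ} {p : ℕ} (VF : PAdicValuedField K p) where
  open CommutativeRing K using (Carrier; _≈_; _*_; 1#)
  open PAdicValuedField VF
  open Valuation VF
  open Recurrence K

  Window : ℕ → Set c
  Window d = Vec (Fin (suc d) → Carrier) (suc d)

  MinimalAtHead : ∀ {d} → ℕ → Fin (suc d) → Window d → Set
  MinimalAtHead k i s = v (lookup s zero i) ≡ just (ℤ.- (+ k)) × (∀ j → just (ℤ.- (+ k)) ≤∞ v (lookup s j i))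

  combine : ∀ {d} → (Fin (suc d) → Carrier) → Window d → Fin (suc d) → Carrier
  combine cs s i = sumFin K (λ j → cs j * lookup s j i)

  MinimalAtHead-shiftIn : ∀ {d k l i} {s : Window d} (cs : Fin (suc d) → Carrier) →
    v (cs zero) ≡ just (ℤ.- (+ l)) → (∀ j → ℤ.- (+ l) <∞ v (cs (suc j))) →
    MinimalAtHead k i s → MinimalAtHead (k ℕ.+ l) i (shiftIn K (combine cs s) s)
  MinimalAtHead-shiftIn {k = k} {l} {i} {s} cs v-cs₀ v-cs (v-s₀ , v-s) = v-head , v-all
    where
    -l-k≡-[k+l] : ℤ.- (+ l) ℤ.+ ℤ.- (+ k) ≡ ℤ.- (+ (k ℕ.+ l))
    -l-k≡-[k+l] = begin
      ℤ.- (+ l) ℤ.+ ℤ.- (+ k)  ≡⟨ ℤP.+-comm (ℤ.- (+ l)) (ℤ.- (+ k)) ⟩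
      ℤ.- (+ k) ℤ.+ ℤ.- (+ l)  ≡⟨ sym (ℤP.neg-distrib-+ (+ k) (+ l)) ⟩
      ℤ.- (+ k ℤ.+ + l)        ≡⟨ cong ℤ.-_ (sym (ℤP.pos-+ k l)) ⟩
      ℤ.- (+ (k ℕ.+ l))        ∎
      where open ≡-Reasoning
    v-combine : v (combine cs s i) ≡ just (ℤ.- (+ (k ℕ.+ l)))
    v-combine = trans
      (v-sumFin-dominant (λ j → cs j * lookup s j i)
        (trans (v-mul _ _) (cong₂ _+∞_ v-cs₀ v-s₀))
        (λ j → subst (_ <∞_) (sym (v-mul _ _)) (+-mono-<∞-≤∞ _ _ (v-cs j) (v-s (suc j)))))
      (cong just -l-k≡-[k+l])
    v-head : v (lookup (shiftIn K (combine cs s) s) zero i) ≡ just (ℤ.- (+ (k ℕ.+ l)))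
    v-head = trans (cong (λ x → v (x i)) (lookup-shiftIn-zero (combine cs s) s)) v-combine
    -[k+l]≤-k : ℤ.- (+ (k ℕ.+ l)) ℤ.≤ ℤ.- (+ k)
    -[k+l]≤-k = ℤP.neg-mono-≤ (+≤+ (ℕP.m≤m+n k l))
    v-all : ∀ j → just (ℤ.- (+ (k ℕ.+ l))) ≤∞ v (lookup (shiftIn K (combine cs s) s) j i)
    v-all = shiftIn-preserves (λ x → just (ℤ.- (+ (k ℕ.+ l))) ≤∞ v (x i)) {combine cs s} {s}
              (subst (_ ≤∞_) (sym v-combine) (≤∞-ℤ ℤP.≤-refl))
              (λ j → ≤-≤∞-trans -[k+l]≤-k (v-s j))

  MinimalAtHead-initState : ∀ m a → a 0 (fromℕ m) ≈ 1# → MinimalAtHead 0 (fromℕ m) (initState K m a)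
  MinimalAtHead-initState m a a₀≈1 = v-a₀ , v-init
    where
    v-a₀ : v (a 0 (fromℕ m)) ≡ just (+ 0)
    v-a₀ = trans (v-cong a₀≈1) v-1#
    v-init : ∀ j → just (+ 0) ≤∞ v (lookup (initState K m a) j (fromℕ m))
    v-init zero    = subst (_ ≤∞_) (sym v-a₀) (≤∞-ℤ ℤP.≤-refl)
    v-init (suc j) = subst (_ ≤∞_) (sym (trans (cong v (initState-fromℕ m a j)) v-0)) ≤∞-∞

  MinimalAtHead-state : ∀ {m} (a : ℕ → Fin (suc m) → Carrier) (e : ℕ → ℕ) (N : ℕ) {i} →
    (∀ n → 1 ≤ n → n ≤ N → v (a n zero) ≡ just (ℤ.- (+ e n))) →
    (∀ n → 1 ≤ n → n ≤ N → ∀ j → ℤ.- (+ e n) <∞ v (a n (suc j))) →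
    MinimalAtHead 0 i (initState K m a) →
    ∀ n → n ≤ N → MinimalAtHead (partialSum e n) i (state K m a n)
  MinimalAtHead-state a e N v-lead v-rest init zero    _   = init
  MinimalAtHead-state a e N v-lead v-rest init (suc n) n<N =
    MinimalAtHead-shiftIn (a (suc n)) (v-lead (suc n) (s≤s z≤n) n<N) (v-rest (suc n) (s≤s z≤n) n<N)
      (MinimalAtHead-state a e N v-lead v-rest init n (ℕP.<⇒≤ n<N))

lemma3p1 : {c ℓ : Level} (K : CommutativeRing c ℓ) (p : ℕ) (VF : PAdicValuedField K p)
    (m : ℕ) → 1 ≤ m → (a : ℕ → Fin (suc m) → CommutativeRing.Carrier K) (N : ℕ) →
    CommutativeRing._≈_ K (a 0 (fromℕ m)) (CommutativeRing.1# K) →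
    (∀ n → 1 ≤ n → n ≤ N →
      (1ℚᵘ Q.≤ PAdicValuedField.∣_∣ₚ VF (a n zero))
      × (∀ (i : Fin m) → PAdicValuedField.∣_∣ₚ VF (a n (suc i)) Q.< PAdicValuedField.∣_∣ₚ VF (a n zero))) →
    ∀ n → 1 ≤ n → n ≤ N →
      PAdicValuedField.∣_∣ₚ VF (convergent K m a n (fromℕ m))
        Q.≃ prodQ (λ h → PAdicValuedField.∣_∣ₚ VF (a h zero)) n
lemma3p1 K p VF m _ a N a₀≈1 bounds n _ n≤N = begin
  absVal p (v (convergent K m a n (fromℕ m)))  ≡⟨ cong (absVal p) (proj₁ last-column) ⟩
  absVal p (just (ℤ.- (+ partialSum e n)))     ≡⟨ absVal-neg (partialSum e n) ⟩
  pow (partialSum e n)                         ≈⟨ QP.≃-sym product ⟩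
  prodQ (λ h → ∣ a h zero ∣ₚ) n                ∎
  where
  open PAdicValuedField VF
  open AbsoluteValue p (ℕ.nonTrivial⇒n>1 p {{prime⇒nonTrivial prime}})
  open ConvergentValuation VF
  open QP.≃-Reasoning

  e : ℕ → ℕ
  e h = absℤ∞ (v (a h zero))

  v-lead : ∀ h → 1 ≤ h → h ≤ N → v (a h zero) ≡ just (ℤ.- (+ e h))
  v-lead h 1≤h h≤N = 1≤absVal⇒nonpositive _ (proj₁ (bounds h 1≤h h≤N))

  ∣a∣≡pow : ∀ h → 1 ≤ h → h ≤ N → ∣ a h zero ∣ₚ ≡ pow (e h)
  ∣a∣≡pow h 1≤h h≤N = trans (cong (absVal p) (v-lead h 1≤h h≤N)) (absVal-neg (e h))

  v-rest : ∀ h → 1 ≤ h → h ≤ N → ∀ j → ℤ.- (+ e h) <∞ v (a h (suc j))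
  v-rest h 1≤h h≤N j = absVal<pow⇒<∞ (e h) _
    (subst (∣ a h (suc j) ∣ₚ Q.<_) (∣a∣≡pow h 1≤h h≤N) (proj₂ (bounds h 1≤h h≤N) j))

  product : prodQ (λ h → ∣ a h zero ∣ₚ) n Q.≃ pow (partialSum e n)
  product = prodQ-pow _ e n (λ h 1≤h h≤n → ∣a∣≡pow h 1≤h (ℕP.≤-trans h≤n n≤N))

  last-column : MinimalAtHead (partialSum e n) (fromℕ m) (state K m a n)
  last-column = MinimalAtHead-state a e N v-lead v-rest (MinimalAtHead-initState m a a₀≈1) n n≤N
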